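{- Let $C'$ be a real $n\times n$ matrix and let $\Pi=\{\pi_1,\ldots,\pi_\ell\}$ be an equitable partition of $C'$ with $n\in\pi_\ell$, such that the quotient matrix $\Pi(C')$ is rooted. Let $S$ be the characteristic matrix of $\Pi$ and let $u$ be a rooted eigenvector of $\Pi(C')$ for $\rho_r(\Pi(C'))$. Then $Su$ is a rooted eigenvector of $C'$ for the eigenvalue $\rho_r(\Pi(C'))$.
   Context: A real vector $(v_1,\ldots,v_k)$ is rooted if $v_i\geq v_k\geq 0$ for $1\le i\le k-1$. A $k\times k$ real matrix $M$ is rooted if for some constant $d$ the first $k-1$ columns of $M+dI_k$ and the row-sum vector of $M+dI_k$ are rooted. $\rho_r(\cdot)$ is the largest real eigenvalue. For a partition $\Pi=\{\pi_1,\ldots,\pi_\ell\}$ of $[n]$ (nonempty parts), its characteristic matrix is the $n\times\ell$ matrix $S=(s_{jb})$ with $s_{jb}=1$ if $j\in\pi_b$ and $0$ otherwise; the quotient matrix of an $n\times n$ matrix $C=(c_{ij})$ is $\Pi(C)=(p_{ab})$ with $p_{ab}=\frac{1}{|\pi_a|}\sum_{i\in\pi_a}\sum_{j\in\pi_b}c_{ij}$; $\Pi$ is an equitable partition of $C$ if $\sum_{j\in\pi_b}c_{ij}=p_{ab}$ for all $a,b$ and all $i\in\pi_a$. -}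

module Defs where

open import Data.Nat using (ℕ; zero; suc)
open import Data.Fin using (Fin; zero; suc; fromℕ; inject₁; _≟_)
open import Data.Product using (Σ; ∃; _×_; _,_)
open import Relation.Nullary using (¬_; yes; no)
open import Relation.Binary.PropositionalEquality using (_≡_)
open import Relation.Binary.Structures using (IsTotalOrder)
open import Algebra.Structures using (IsCommutativeRing)

-- The real numbers, axiomatised as a complete ordered field
-- (Dedekind-complete: every nonempty predicate bounded above has a least upper bound).
-- Up to isomorphism this is exactly ℝ.
record RealField : Set₁ where
  infixl 6 _+_
  infixl 7 _*_
  infix  4 _≤_
  field
    Carrier : Set
    _+_ _*_ : Carrier → Carrier → Carrier
    -_      : Carrier → Carrier
    0# 1#   : Carrier
    _⁻¹     : Carrier → Carrier
    _≤_     : Carrier → Carrier → Set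
    isCommutativeRing : IsCommutativeRing _≡_ _+_ _*_ -_ 0# 1#
    0≢1       : ¬ (0# ≡ 1#)
    ⁻¹-inverse : ∀ x → ¬ (x ≡ 0#) → x * (x ⁻¹) ≡ 1#
    isTotalOrder : IsTotalOrder _≡_ _≤_
    +-mono-≤  : ∀ {x y} z → x ≤ y → x + z ≤ y + z
    *-nonneg  : ∀ {x y} → 0# ≤ x → 0# ≤ y → 0# ≤ x * y
    complete  : (P : Carrier → Set) → (∃ λ x → P x) →
                (∃ λ b → ∀ x → P x → x ≤ b) →
                ∃ λ s → (∀ x → P x → x ≤ s) × (∀ b → (∀ x → P x → x ≤ b) → s ≤ b)

module _ (R : RealField) where
  open RealField R

  Vector : ℕ → Set
  Vector n = Fin n → Carrier

  Matrix : ℕ → ℕ → Set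
  Matrix n m = Fin n → Fin m → Carrier

  ∑ : ∀ {n} → (Fin n → Carrier) → Carrier
  ∑ {zero}  f = 0#
  ∑ {suc n} f = f zero + ∑ (λ i → f (suc i))

  _*ᵥ_ : ∀ {n m} → Matrix n m → Vector m → Vector n
  (M *ᵥ v) i = ∑ (λ j → M i j * v j)

  _*ₛ_ : Carrier → ∀ {n} → Vector n → Vector n
  (c *ₛ v) i = c * v i

  identity : ∀ {k} → Matrix k k
  identity i j with i ≟ j
  ... | yes _ = 1#
  ... | no  _ = 0#

  _+ₘ_ : ∀ {k} → Matrix k k → Matrix k k → Matrix k k
  (M +ₘ N) i j = M i j + N i j

  IsRootedVector : ∀ {k'} → Vector (suc k') → Set
  IsRootedVector {k'} v = (∀ i → v (fromℕ k') ≤ v i) × (0# ≤ v (fromℕ k'))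

  rowSums : ∀ {k} → Matrix k k → Vector k
  rowSums M i = ∑ (λ j → M i j)

  column : ∀ {k} → Matrix k k → Fin k → Vector k
  column M j i = M i j

  IsRootedMatrix : ∀ {k'} → Matrix (suc k') (suc k') → Set
  IsRootedMatrix {k'} M =
    ∃ λ d → let N = M +ₘ (λ i j → d * identity i j) in
      (∀ (c : Fin k') → IsRootedVector (column N (inject₁ c))) × IsRootedVector (rowSums N)

  IsEigenvector : ∀ {k} → Matrix k k → Carrier → Vector k → Set
  IsEigenvector M λ' v = (∃ λ i → ¬ (v i ≡ 0#)) × (∀ i → (M *ᵥ v) i ≡ (λ' *ₛ v) i)

  IsEigenvalue : ∀ {k} → Matrix k k → Carrier → Set
  IsEigenvalue M λ' = ∃ λ v → IsEigenvector M λ' v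

  IsLargestRealEigenvalue : ∀ {k} → Matrix k k → Carrier → Set
  IsLargestRealEigenvalue M λ' = IsEigenvalue M λ' × (∀ μ → IsEigenvalue M μ → μ ≤ λ')

  IsRootedEigenvector : ∀ {k'} → Matrix (suc k') (suc k') → Carrier → Vector (suc k') → Set
  IsRootedEigenvector M λ' v = IsEigenvector M λ' v × IsRootedVector v

  -- A partition Π = {π_1,…,π_ℓ} of [n] is given by the map part : Fin n → Fin ℓ
  -- (j ∈ π_b iff part j ≡ b); all parts nonempty means part is surjective.
  IsPartition : ∀ {n ℓ} → (Fin n → Fin ℓ) → Set
  IsPartition part = ∀ b → ∃ λ j → part j ≡ b

  charMatrix : ∀ {n ℓ} → (Fin n → Fin ℓ) → Matrix n ℓ
  charMatrix part j b with part j ≟ b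
  ... | yes _ = 1#
  ... | no  _ = 0#

  -- quotient matrix Π(C): p_ab = |π_a|⁻¹ Σ_{i∈π_a} Σ_{j∈π_b} c_ij
  quotientMatrix : ∀ {n ℓ} → Matrix n n → (Fin n → Fin ℓ) → Matrix ℓ ℓ
  quotientMatrix C part a b =
    (∑ (λ i → S i a)) ⁻¹ * ∑ (λ i → ∑ (λ j → S i a * S j b * C i j))
    where S = charMatrix part

  IsEquitable : ∀ {n ℓ} → Matrix n n → (Fin n → Fin ℓ) → Set
  IsEquitable C part = ∀ a b i → part i ≡ a →
    ∑ (λ j → charMatrix part j b * C i j) ≡ quotientMatrix C part a b

{-# OPTIONS --safe #-}
module Submission where

-- Equitability says exactly that C S = S Π(C): row i of C S is row (part i) of Π(C).
-- So S carries eigenvectors of Π(C) to eigenvectors of C with the same eigenvalue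
-- (nonzero because every part is nonempty), and since (S u)_j = u_(part j) with the
-- last index lying in the last part, S u inherits rootedness from u.

open import Defs
open import Data.Nat using (ℕ; zero; suc)
open import Data.Fin using (Fin; zero; suc; fromℕ; _≟_)
open import Data.Fin.Properties using (suc-injective)
open import Data.Product using (_,_)
open import Data.Empty using (⊥-elim)
open import Relation.Nullary using (yes; no)
open import Function using (_∘′_)
open import Relation.Binary.PropositionalEquality
open import Algebra.Bundles using (CommutativeRing)
import Algebra.Properties.Semiring.Sum as SemiringSum

module _ (R : RealField) where
  open RealField R
  open ≡-Reasoning

  commutativeRing : CommutativeRing _ _
  commutativeRing = record { isCommutativeRing = isCommutativeRing }

  open CommutativeRing commutativeRing
    using (semiring; *-comm; *-assoc; +-identityˡ; +-identityʳ; *-identityˡ; zeroˡ)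
  open SemiringSum semiring
    using (sum; sum-cong-≗; sum-replicate-zero; ∑-comm; *-distribˡ-sum; *-distribʳ-sum)

  -- ∑ and the library's sum unfold alike, but agree only propositionally at variable length.
  ∑≡sum : ∀ {m} (f : Vector R m) → ∑ R f ≡ sum f
  ∑≡sum {zero}  f = refl
  ∑≡sum {suc m} f = cong (f zero +_) (∑≡sum (λ i → f (suc i)))

  ∑-cong : ∀ {m} {f g : Vector R m} → f ≗ g → ∑ R f ≡ ∑ R g
  ∑-cong {f = f} {g} f≗g = trans (∑≡sum f) (trans (sum-cong-≗ f≗g) (sym (∑≡sum g)))

  ∑-zero : ∀ {m} {f : Vector R m} → (∀ i → f i ≡ 0#) → ∑ R f ≡ 0#
  ∑-zero {m} {f} f≡0 = begin
    ∑ R f                       ≡⟨ ∑-cong f≡0 ⟩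
    ∑ R (λ (_ : Fin m) → 0#)    ≡⟨ ∑≡sum {m} (λ _ → 0#) ⟩
    sum (λ (_ : Fin m) → 0#)    ≡⟨ sum-replicate-zero m ⟩
    0#                          ∎

  ∑-distribˡ : ∀ {m} x (f : Vector R m) → x * ∑ R f ≡ ∑ R (λ i → x * f i)
  ∑-distribˡ x f = begin
    x * ∑ R f                ≡⟨ cong (x *_) (∑≡sum f) ⟩
    x * sum f                ≡⟨ *-distribˡ-sum x f ⟩
    sum (λ i → x * f i)      ≡⟨ sym (∑≡sum (λ i → x * f i)) ⟩
    ∑ R (λ i → x * f i)      ∎

  ∑-distribʳ : ∀ {m} x (f : Vector R m) → ∑ R f * x ≡ ∑ R (λ i → f i * x)
  ∑-distribʳ x f = begin
    ∑ R f * x                ≡⟨ cong (_* x) (∑≡sum f) ⟩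
    sum f * x                ≡⟨ *-distribʳ-sum x f ⟩
    sum (λ i → f i * x)      ≡⟨ sym (∑≡sum (λ i → f i * x)) ⟩
    ∑ R (λ i → f i * x)      ∎

  ∑-swap : ∀ {m k} (g : Fin m → Fin k → Carrier) →
    ∑ R (λ i → ∑ R (g i)) ≡ ∑ R (λ j → ∑ R (λ i → g i j))
  ∑-swap g = begin
    ∑ R (λ i → ∑ R (g i))              ≡⟨ ∑-cong (λ i → ∑≡sum (g i)) ⟩
    ∑ R (λ i → sum (g i))              ≡⟨ ∑≡sum (λ i → sum (g i)) ⟩
    sum (λ i → sum (g i))              ≡⟨ ∑-comm g ⟩
    sum (λ j → sum (λ i → g i j))      ≡⟨ sym (∑≡sum (λ j → sum (λ i → g i j))) ⟩
    ∑ R (λ j → sum (λ i → g i j))      ≡⟨ sym (∑-cong (λ j → ∑≡sum (λ i → g i j))) ⟩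
    ∑ R (λ j → ∑ R (λ i → g i j))      ∎

  _*ₘ_ : ∀ {n m k} → Matrix R n m → Matrix R m k → Matrix R n k
  (M *ₘ N) i c = ∑ R (λ k → M i k * N k c)

  *ᵥ-assoc : ∀ {n m k} (M : Matrix R n m) (N : Matrix R m k) (v : Vector R k) →
    _*ᵥ_ R M (_*ᵥ_ R N v) ≗ _*ᵥ_ R (M *ₘ N) v
  *ᵥ-assoc M N v i = begin
      ∑ R (λ k → M i k * ∑ R (λ c → N k c * v c))
    ≡⟨ ∑-cong (λ k → ∑-distribˡ (M i k) (λ c → N k c * v c)) ⟩
      ∑ R (λ k → ∑ R (λ c → M i k * (N k c * v c)))
    ≡⟨ ∑-swap (λ k c → M i k * (N k c * v c)) ⟩
      ∑ R (λ c → ∑ R (λ k → M i k * (N k c * v c)))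
    ≡⟨ ∑-cong (λ c → ∑-cong (λ k → sym (*-assoc (M i k) (N k c) (v c)))) ⟩
      ∑ R (λ c → ∑ R (λ k → M i k * N k c * v c))
    ≡⟨ ∑-cong (λ c → sym (∑-distribʳ (v c) (λ k → M i k * N k c))) ⟩
      ∑ R (λ c → (M *ₘ N) i c * v c) ∎

  ∑-pick : ∀ {m} (δ f : Vector R m) (k : Fin m) →
    δ k ≡ 1# → (∀ b → k ≢ b → δ b ≡ 0#) → ∑ R (λ b → δ b * f b) ≡ f k
  ∑-pick δ f zero δk≡1 δ≡0 = begin
      δ zero * f zero + ∑ R (λ b → δ (suc b) * f (suc b))
    ≡⟨ cong₂ _+_ (trans (cong (_* f zero) δk≡1) (*-identityˡ (f zero)))
         (∑-zero (λ b → trans (cong (_* f (suc b)) (δ≡0 (suc b) λ ())) (zeroˡ (f (suc b))))) ⟩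
      f zero + 0#
    ≡⟨ +-identityʳ (f zero) ⟩
      f zero ∎
  ∑-pick δ f (suc k) δk≡1 δ≡0 = begin
      δ zero * f zero + ∑ R (λ b → δ (suc b) * f (suc b))
    ≡⟨ cong₂ _+_ (trans (cong (_* f zero) (δ≡0 zero λ ())) (zeroˡ (f zero)))
         (∑-pick (δ ∘′ suc) (f ∘′ suc) k δk≡1 (λ b k≢b → δ≡0 (suc b) (k≢b ∘′ suc-injective))) ⟩
      0# + f (suc k)
    ≡⟨ +-identityˡ (f (suc k)) ⟩
      f (suc k) ∎

  charMatrix-*ᵥ : ∀ {n ℓ} (part : Fin n → Fin ℓ) (u : Vector R ℓ) →
    _*ᵥ_ R (charMatrix R part) u ≗ u ∘′ part
  charMatrix-*ᵥ part u j = ∑-pick (charMatrix R part j) u (part j) own-part other-part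
    where
    own-part : charMatrix R part j (part j) ≡ 1#
    own-part with part j ≟ part j
    ... | yes _   = refl
    ... | no  part-j≢part-j = ⊥-elim (part-j≢part-j refl)

    other-part : ∀ b → part j ≢ b → charMatrix R part j b ≡ 0#
    other-part b j∉b with part j ≟ b
    ... | yes j∈b = ⊥-elim (j∉b j∈b)
    ... | no  _   = refl

  charMatrix-*ᵥ-rooted : ∀ {n' ℓ'} (part : Fin (suc n') → Fin (suc ℓ')) →
    part (fromℕ n') ≡ fromℕ ℓ' → ∀ {u} → IsRootedVector R u →
    IsRootedVector R (_*ᵥ_ R (charMatrix R part) u)
  charMatrix-*ᵥ-rooted {n'} part last↦last {u} (last≤u , 0≤last) =
    (λ i → subst₂ _≤_ (sym Su-last) (sym (Su≡u∘part i)) (last≤u (part i)))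
    , subst (0# ≤_) (sym Su-last) 0≤last
    where
    Su≡u∘part : _*ᵥ_ R (charMatrix R part) u ≗ u ∘′ part
    Su≡u∘part = charMatrix-*ᵥ part u

    Su-last : _*ᵥ_ R (charMatrix R part) u (fromℕ n') ≡ u (fromℕ _)
    Su-last = trans (Su≡u∘part (fromℕ n')) (cong u last↦last)

  module _ {n ℓ} (C : Matrix R n n) (part : Fin n → Fin ℓ) (equitable : IsEquitable R C part) where

    private
      S = charMatrix R part
      Q = quotientMatrix R C part

    equitable⇒*ₘ-charMatrix : ∀ i b → (C *ₘ S) i b ≡ Q (part i) b
    equitable⇒*ₘ-charMatrix i b =
      trans (∑-cong (λ k → *-comm (C i k) (S k b))) (equitable (part i) b i refl)

    equitable⇒*ᵥ-charMatrix : ∀ u → _*ᵥ_ R C (_*ᵥ_ R S u) ≗ _*ᵥ_ R Q u ∘′ part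
    equitable⇒*ᵥ-charMatrix u i =
      trans (*ᵥ-assoc C S u i) (∑-cong (λ b → cong (_* u b) (equitable⇒*ₘ-charMatrix i b)))

    equitable⇒charMatrix-*ᵥ-eigenvector : IsPartition R part → ∀ {λ′ u} →
      IsEigenvector R Q λ′ u → IsEigenvector R C λ′ (_*ᵥ_ R S u)
    equitable⇒charMatrix-*ᵥ-eigenvector surjective {λ′} {u} ((b , ub≢0) , Qu≡λu)
      with j , pj≡b ← surjective b =
      (j , λ Suj≡0 → ub≢0 (trans (cong u (sym pj≡b)) (trans (sym (Su≡u∘part j)) Suj≡0)))
      , λ i → begin
        _*ᵥ_ R C (_*ᵥ_ R S u) i   ≡⟨ equitable⇒*ᵥ-charMatrix u i ⟩
        _*ᵥ_ R Q u (part i)       ≡⟨ Qu≡λu (part i) ⟩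
        λ′ * u (part i)           ≡⟨ cong (λ′ *_) (sym (Su≡u∘part i)) ⟩
        λ′ * _*ᵥ_ R S u i         ∎
      where
      Su≡u∘part : _*ᵥ_ R S u ≗ u ∘′ part
      Su≡u∘part = charMatrix-*ᵥ part u

lemma4p4 : (R : RealField) → ∀ {n' ℓ' : ℕ}
    (C : Matrix R (suc n') (suc n')) (part : Fin (suc n') → Fin (suc ℓ')) →
    IsPartition R part →
    part (fromℕ n') ≡ fromℕ ℓ' →
    IsEquitable R C part →
    IsRootedMatrix R (quotientMatrix R C part) →
    (ρ : RealField.Carrier R) →
    IsLargestRealEigenvalue R (quotientMatrix R C part) ρ →
    (u : Vector R (suc ℓ')) →
    IsRootedEigenvector R (quotientMatrix R C part) ρ u →
    IsRootedEigenvector R C ρ (_*ᵥ_ R (charMatrix R part) u)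
lemma4p4 R C part surjective last↦last equitable _ ρ _ u (eigenvector , rooted) =
  equitable⇒charMatrix-*ᵥ-eigenvector R C part equitable surjective eigenvector ,
  charMatrix-*ᵥ-rooted R part last↦last rooted
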